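{- A matroid is simple graphic if and only if it is isomorphic to a simple segment binary matroid.
   Context: A matroid is simple graphic if it is (isomorphic to) the cycle matroid of a simple undirected graph (elements: edges; circuits: cycles). For a matrix $A$ over $\mathbb{Z}_2$, $M[A]$ denotes its column (vector) matroid over $\mathbb{Z}_2$ (a binary matroid). $M[A]$ is a segment binary matroid if every column of $A$ has the consecutive $1$'s property (its $1$'s occupy consecutive coordinates); it is a simple segment binary matroid if moreover the columns of $A$ are non-zero and pairwise distinct. -}

module Defs where

open import Data.Nat using (ℕ; zero; suc; _<_; _≥_)
open import Data.Bool using (Bool; true; false; _xor_)
open import Data.Fin using (Fin; inject₁; fromℕ) renaming (_≤_ to _≤ᶠ_)
import Data.Fin as F
open import Data.Fin.Subset using (Subset; _∈_; _∉_; _⊆_; ∣_∣; ⁅_⁆; _∪_; ⊥)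
open import Data.Vec using (Vec; []; _∷_; lookup; tabulate; replicate; zipWith)
open import Data.Product using (Σ; ∃; ∃-syntax; _×_; _,_; proj₁; proj₂)
open import Data.Sum using (_⊎_)
open import Function.Bundles using (_↔_; Inverse; _⇔_)
open import Function.Definitions using (Injective)
open import Relation.Binary.PropositionalEquality using (_≡_; _≢_)
open import Relation.Nullary using (¬_)

record IndepSystem : Set₁ where
  field
    size  : ℕ
    Indep : Subset size → Set

record Matroid : Set₁ where
  field
    system : IndepSystem
  open IndepSystem system public
  field
    indep-∅   : Indep ⊥
    indep-⊆   : ∀ {I J} → I ⊆ J → Indep J → Indep I
    exchange  : ∀ {I J} → Indep I → Indep J → ∣ I ∣ < ∣ J ∣ →
                ∃[ x ] (x ∈ J × x ∉ I × Indep (I ∪ ⁅ x ⁆))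

image : ∀ {n m} → Fin n ↔ Fin m → Subset n → Subset m
image σ S = tabulate (λ j → lookup S (Inverse.from σ j))

record _≅_ (M N : IndepSystem) : Set where
  open IndepSystem
  field
    σ        : Fin (size M) ↔ Fin (size N)
    preserve : ∀ (S : Subset (size M)) → Indep M S ⇔ Indep N (image σ S)

record Graph : Set where
  field
    nV   : ℕ
    nE   : ℕ
    ends : Fin nE → Fin nV × Fin nV

module _ (G : Graph) where
  open Graph G

  Joins : Fin nE → Fin nV → Fin nV → Set
  Joins e a b = ends e ≡ (a , b) ⊎ ends e ≡ (b , a)

  IsSimple : Set
  IsSimple = (∀ e → proj₁ (ends e) ≢ proj₂ (ends e))
           × (∀ e f → Joins e (proj₁ (ends f)) (proj₂ (ends f)) → e ≡ f)

  record Cycle : Set where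
    field
      k     : ℕ
      vs    : Fin (suc k) → Fin nV
      es    : Fin (suc k) → Fin nE
      vs-inj : Injective _≡_ _≡_ vs
      es-inj : Injective _≡_ _≡_ es
      step  : ∀ (i : Fin k) → Joins (es (inject₁ i)) (vs (inject₁ i)) (vs (F.suc i))
      close : Joins (es (fromℕ k)) (vs (fromℕ k)) (vs F.zero)

  CycleIn : Cycle → Subset nE → Set
  CycleIn C S = ∀ i → Cycle.es C i ∈ S

  cycleMatroid : IndepSystem
  cycleMatroid = record { size = nE ; Indep = λ S → ∀ (C : Cycle) → ¬ CycleIn C S }

IsSimpleGraphic : Matroid → Set
IsSimpleGraphic M = Σ Graph λ G → IsSimple G × (Matroid.system M ≅ cycleMatroid G)

-- Binary matroids. A matrix over ℤ₂ with r rows and n columns is given by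
-- its columns A : Fin n → Vec Bool r (Bool = ℤ₂, xor = addition).

Matrix₂ : ℕ → ℕ → Set
Matrix₂ r n = Fin n → Vec Bool r

zeroVec : ∀ {r} → Vec Bool r
zeroVec = replicate _ false

colSum : ∀ {r n} → Matrix₂ r n → Subset n → Vec Bool r
colSum {r} {zero}  A []            = zeroVec
colSum {r} {suc n} A (true  ∷ T)   = zipWith _xor_ (A F.zero) (colSum (λ j → A (F.suc j)) T)
colSum {r} {suc n} A (false ∷ T)   = colSum (λ j → A (F.suc j)) T

-- columns in S are linearly independent over ℤ₂: the only ℤ₂-combination
-- (i.e. subset T ⊆ S) of them summing to zero is the trivial one
LinIndep₂ : ∀ {r n} → Matrix₂ r n → Subset n → Set
LinIndep₂ A S = ∀ T → T ⊆ S → colSum A T ≡ zeroVec → T ≡ ⊥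

M[_] : ∀ {r n} → Matrix₂ r n → IndepSystem
M[_] {r} {n} A = record { size = n ; Indep = LinIndep₂ A }

Consecutive1s : ∀ {r} → Vec Bool r → Set
Consecutive1s c = ∀ i j k → i ≤ᶠ j → j ≤ᶠ k →
                  lookup c i ≡ true → lookup c k ≡ true → lookup c j ≡ true

IsSegment : ∀ {r n} → Matrix₂ r n → Set
IsSegment A = ∀ j → Consecutive1s (A j)

IsSimpleSegment : ∀ {r n} → Matrix₂ r n → Set
IsSimpleSegment A = IsSegment A × (∀ j → A j ≢ zeroVec) × Injective _≡_ _≡_ A

IsoToSimpleSegmentBinary : Matroid → Set
IsoToSimpleSegmentBinary M =
  ∃[ r ] ∃[ n ] Σ (Matrix₂ r n) λ A → IsSimpleSegment A × (Matroid.system M ≅ M[ A ])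

module Submission where

-- A simple graph on the vertices 0, …, r is represented over ℤ₂ by the matrix
-- whose column for an edge {a, b} is the indicator vector of the part of the
-- path 0 — 1 — ⋯ — r between a and b ("interval a b", indexed by the r path edges).
-- These columns are exactly the nonzero vectors with the consecutive 1's property,
-- and distinct edges give distinct columns.  The heart of the proof is that the
-- vector matroid of this matrix is the cycle matroid of the graph:
--   * the columns of the edges of a cycle sum to zero, since interval a b is the
--     sum of the "potentials" interval 0 a and interval 0 b and the sum telescopes;
--   * conversely, if a nonempty set T of columns sums to zero, the linear functional
--     "incidence with vertex w" shows that no edge of T has an end met by no other
--     edge of T; a non-backtracking walk in T then repeats a vertex, and its first
--     repetition closes a cycle inside T.

open import Defs
open import Function.Bundles using (_⇔_; mk⇔)

open import Algebra.Bundles using (CommutativeRing)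
open import Data.Bool using (Bool; true; false; _xor_)
open import Data.Bool.Properties using (xor-∧-commutativeRing; xor-same; xor-comm; xor-assoc)
open import Data.Empty using (⊥-elim) renaming (⊥ to ⊥₀)
open import Data.Fin using (Fin; zero; suc; toℕ; inject₁; fromℕ; _≟_) renaming (_≤_ to _≤ᶠ_)
open import Data.Fin.Properties using (suc-injective; toℕ-injective; toℕ-inject₁; toℕ-fromℕ; toℕ<n; any?; pigeonhole)
open import Data.Fin.Subset using (Subset; _∈_; _∉_; _⊆_; ⊥)
open import Data.Fin.Subset.Properties using (_∈?_; ∉⊥; Empty-unique; nonempty?)
open import Data.Nat using (ℕ; zero; suc; _+_; _<_; z≤n; s≤s)
open import Data.Nat.Induction using (<-wellFounded)
open import Data.Nat.Properties using (anyUpTo?; <-cmp; n<1+n; m≤n⇒∃[o]m+o≡n; +-comm; +-cancelʳ-≡; +-monoˡ-<; ≤-<-trans)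
open import Data.Product as Product using (Σ; ∃; ∃-syntax; _×_; _,_; proj₁; proj₂)
open import Data.Sum as Sum using (_⊎_; inj₁; inj₂)
open import Data.Vec using (Vec; []; _∷_; here; there; lookup; zipWith)
open import Data.Vec.Properties using (lookup-zipWith; lookup-replicate; zipWith-replicate; tabulate∘lookup; tabulate-cong)
open import Function using (_∘_; id; case_of_)
open import Function.Definitions using (Injective)
import Function.Properties.Equivalence as ⇔
open import Induction.WellFounded using (Acc; acc)
open import Relation.Binary using (tri<; tri≈; tri>)
open import Relation.Binary.PropositionalEquality
open import Relation.Nullary using (¬_; Dec; yes; no; does; ¬?)
open import Relation.Nullary.Decidable using (dec-true; dec-false; _×-dec_; _⊎-dec_)
open import Relation.Unary using (Decidable)

open CommutativeRing xor-∧-commutativeRing using (+-monoid; +-commutativeSemigroup)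
open import Algebra.Properties.Monoid.Sum +-monoid using (sum; sum-cong-≗; sum-init-last)
open import Algebra.Properties.CommutativeSemigroup +-commutativeSemigroup using (x∙yz≈y∙xz; interchange)

private
  variable
    m n r : ℕ

_==_ : Fin n → Fin n → Bool
a == b = does (a ≟ b)

==-refl : (a : Fin n) → a == a ≡ true
==-refl a = dec-true (a ≟ a) refl

==-≢ : {a b : Fin n} → a ≢ b → a == b ≡ false
==-≢ {a = a} {b} = dec-false (a ≟ b)

==⇒≡ : (a b : Fin n) → a == b ≡ true → a ≡ b
==⇒≡ a b eq with a ≟ b
... | yes a≡b = a≡b

telescope : ∀ k (g : Fin (suc k) → Bool) →
            sum (λ i → g (inject₁ i) xor g (suc i)) ≡ g zero xor g (fromℕ k)
telescope zero    g = sym (xor-same (g zero))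
telescope (suc k) g = begin
  (g zero xor g (suc zero)) xor sum (λ i → g (suc (inject₁ i)) xor g (suc (suc i)))
    ≡⟨ cong ((g zero xor g (suc zero)) xor_) (telescope k (g ∘ suc)) ⟩
  (g zero xor g (suc zero)) xor (g (suc zero) xor g (fromℕ (suc k)))
    ≡⟨ xor-assoc (g zero) _ _ ⟩
  g zero xor (g (suc zero) xor (g (suc zero) xor g (fromℕ (suc k))))
    ≡⟨ cong (g zero xor_) (sym (xor-assoc (g (suc zero)) _ _)) ⟩
  g zero xor ((g (suc zero) xor g (suc zero)) xor g (fromℕ (suc k)))
    ≡⟨ cong (λ x → g zero xor (x xor g (fromℕ (suc k)))) (xor-same (g (suc zero))) ⟩
  g zero xor g (fromℕ (suc k)) ∎
  where open ≡-Reasoning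

cyclic-telescope : ∀ k (g h : Fin (suc k) → Bool) →
                   (∀ (i : Fin k) → h (inject₁ i) ≡ g (inject₁ i) xor g (suc i)) →
                   h (fromℕ k) ≡ g (fromℕ k) xor g zero →
                   sum h ≡ false
cyclic-telescope k g h steps close = begin
  sum h
    ≡⟨ sum-init-last h ⟩
  sum (h ∘ inject₁) xor h (fromℕ k)
    ≡⟨ cong₂ _xor_ (sum-cong-≗ {x = h ∘ inject₁} steps) close ⟩
  sum (λ i → g (inject₁ i) xor g (suc i)) xor (g (fromℕ k) xor g zero)
    ≡⟨ cong (_xor (g (fromℕ k) xor g zero)) (telescope k g) ⟩
  (g zero xor g (fromℕ k)) xor (g (fromℕ k) xor g zero)
    ≡⟨ cong ((g zero xor g (fromℕ k)) xor_) (xor-comm (g (fromℕ k)) (g zero)) ⟩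
  (g zero xor g (fromℕ k)) xor (g zero xor g (fromℕ k))
    ≡⟨ xor-same (g zero xor g (fromℕ k)) ⟩
  false ∎
  where open ≡-Reasoning

_⊕_ : Vec Bool r → Vec Bool r → Vec Bool r
x ⊕ y = zipWith _xor_ x y

IsLinear : (Vec Bool r → Bool) → Set
IsLinear L = ∀ x y → L (x ⊕ y) ≡ L x xor L y

linear-zero : (L : Vec Bool r → Bool) → IsLinear L → L zeroVec ≡ false
linear-zero L linear = begin
  L zeroVec                 ≡⟨ cong L (sym (zipWith-replicate _xor_ false false)) ⟩
  L (zeroVec ⊕ zeroVec)     ≡⟨ linear zeroVec zeroVec ⟩
  L zeroVec xor L zeroVec   ≡⟨ xor-same (L zeroVec) ⟩
  false ∎
  where open ≡-Reasoning

coordinate-linear : (c : Fin r) → IsLinear (λ x → lookup x c)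
coordinate-linear c = lookup-zipWith _xor_ c

vec-ext : {x y : Vec Bool r} → (∀ c → lookup x c ≡ lookup y c) → x ≡ y
vec-ext {x = x} {y} same =
  trans (sym (tabulate∘lookup x)) (trans (tabulate-cong same) (tabulate∘lookup y))

subsetSum : (Fin n → Bool) → Subset n → Bool
subsetSum f []          = false
subsetSum f (true  ∷ T) = f zero xor subsetSum (f ∘ suc) T
subsetSum f (false ∷ T) = subsetSum (f ∘ suc) T

linear-colSum : (L : Vec Bool r → Bool) → IsLinear L →
                (A : Matrix₂ r n) (T : Subset n) → L (colSum A T) ≡ subsetSum (L ∘ A) T
linear-colSum L linear A []          = linear-zero L linear
linear-colSum L linear A (true  ∷ T) =
  trans (linear (A zero) _) (cong (L (A zero) xor_) (linear-colSum L linear (A ∘ suc) T))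
linear-colSum L linear A (false ∷ T) = linear-colSum L linear (A ∘ suc) T

colSum-cong : {A B : Matrix₂ r n} → (∀ j → A j ≡ B j) → ∀ T → colSum A T ≡ colSum B T
colSum-cong same []          = refl
colSum-cong same (true  ∷ T) = cong₂ (zipWith _xor_) (same zero) (colSum-cong (same ∘ suc) T)
colSum-cong same (false ∷ T) = colSum-cong (same ∘ suc) T

subsetSum-zero : (f : Fin n → Bool) (T : Subset n) → (∀ j → j ∈ T → f j ≡ false) →
                 subsetSum f T ≡ false
subsetSum-zero f []          _      = refl
subsetSum-zero f (true  ∷ T) vanish =
  trans (cong (_xor subsetSum (f ∘ suc) T) (vanish zero here))
        (subsetSum-zero (f ∘ suc) T (λ j → vanish (suc j) ∘ there))
subsetSum-zero f (false ∷ T) vanish = subsetSum-zero (f ∘ suc) T (λ j → vanish (suc j) ∘ there)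

subsetSum-unique : (f : Fin n → Bool) (T : Subset n) {e : Fin n} → e ∈ T → f e ≡ true →
                   (∀ j → j ∈ T → f j ≡ true → j ≡ e) → subsetSum f T ≡ true
subsetSum-unique f (true ∷ T) here fe unique =
  trans (cong (_xor subsetSum (f ∘ suc) T) fe)
        (cong (true xor_) (subsetSum-zero (f ∘ suc) T others))
  where
  others : ∀ j → j ∈ T → f (suc j) ≡ false
  others j j∈T with f (suc j) in fj
  ... | false = refl
  ... | true  = case unique (suc j) (there j∈T) fj of λ ()
subsetSum-unique f (false ∷ T) (there e∈T) fe unique =
  subsetSum-unique (f ∘ suc) T e∈T fe (λ j j∈T fj → suc-injective (unique (suc j) (there j∈T) fj))
subsetSum-unique f (true ∷ T) (there e∈T) fe unique with f zero in f0
... | true  = case unique zero here f0 of λ ()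
... | false =
  subsetSum-unique (f ∘ suc) T e∈T fe (λ j j∈T fj → suc-injective (unique (suc j) (there j∈T) fj))

insert : Fin n → Subset n → Subset n
insert zero    (_ ∷ T) = true ∷ T
insert (suc x) (b ∷ T) = b ∷ insert x T

∈-insert-self : (x : Fin n) (T : Subset n) → x ∈ insert x T
∈-insert-self zero    (_ ∷ T) = here
∈-insert-self (suc x) (_ ∷ T) = there (∈-insert-self x T)

∈-insert-mono : (x : Fin n) {T : Subset n} {y : Fin n} → y ∈ T → y ∈ insert x T
∈-insert-mono zero    here        = here
∈-insert-mono zero    (there y∈T) = there y∈T
∈-insert-mono (suc x) here        = here
∈-insert-mono (suc x) (there y∈T) = there (∈-insert-mono x y∈T)

∈-insert⁻ : (x : Fin n) (T : Subset n) {y : Fin n} → y ∈ insert x T → x ≡ y ⊎ y ∈ T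
∈-insert⁻ zero    (_ ∷ T) here        = inj₁ refl
∈-insert⁻ zero    (_ ∷ T) (there y∈T) = inj₂ (there y∈T)
∈-insert⁻ (suc x) (_ ∷ T) here        = inj₂ here
∈-insert⁻ (suc x) (_ ∷ T) (there y∈)  = Sum.map (cong suc) there (∈-insert⁻ x T y∈)

subsetSum-insert : (f : Fin n → Bool) (x : Fin n) (T : Subset n) → x ∉ T →
                   subsetSum f (insert x T) ≡ f x xor subsetSum f T
subsetSum-insert f zero    (true  ∷ T) x∉T = ⊥-elim (x∉T here)
subsetSum-insert f zero    (false ∷ T) _   = refl
subsetSum-insert f (suc x) (false ∷ T) x∉T = subsetSum-insert (f ∘ suc) x T (x∉T ∘ there)
subsetSum-insert f (suc x) (true  ∷ T) x∉T =
  trans (cong (f zero xor_) (subsetSum-insert (f ∘ suc) x T (x∉T ∘ there)))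
        (x∙yz≈y∙xz (f zero) (f (suc x)) (subsetSum (f ∘ suc) T))

range : (Fin m → Fin n) → Subset n
range {zero}  g = ⊥
range {suc m} g = insert (g zero) (range (g ∘ suc))

range⁺ : (g : Fin m → Fin n) (i : Fin m) → g i ∈ range g
range⁺ g zero    = ∈-insert-self (g zero) (range (g ∘ suc))
range⁺ g (suc i) = ∈-insert-mono (g zero) (range⁺ (g ∘ suc) i)

range⁻ : (g : Fin m → Fin n) {y : Fin n} → y ∈ range g → ∃[ i ] g i ≡ y
range⁻ {zero}  g y∈ = ⊥-elim (∉⊥ y∈)
range⁻ {suc m} g y∈ with ∈-insert⁻ (g zero) (range (g ∘ suc)) y∈
... | inj₁ g0≡y = zero , g0≡y
... | inj₂ y∈′  = Product.map suc id (range⁻ (g ∘ suc) y∈′)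

subsetSum-range : (f : Fin n → Bool) (g : Fin m → Fin n) → Injective _≡_ _≡_ g →
                  subsetSum f (range g) ≡ sum (f ∘ g)
subsetSum-range {m = zero}  f g _   = subsetSum-zero f ⊥ (λ _ → ⊥-elim ∘ ∉⊥)
subsetSum-range {m = suc m} f g inj =
  trans (subsetSum-insert f (g zero) (range (g ∘ suc)) fresh)
        (cong (f (g zero) xor_) (subsetSum-range f (g ∘ suc) (suc-injective ∘ inj)))
  where
  fresh : g zero ∉ range (g ∘ suc)
  fresh g0∈ with range⁻ (g ∘ suc) g0∈
  ... | i , gi≡g0 = case inj gi≡g0 of λ ()

-- interval a b ∈ ℤ₂^r: for vertices a, b of the path 0 — 1 — ⋯ — r, the set of
-- path edges (coordinate c is the edge joining c and c+1) lying between a and b.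
interval : Fin (suc r) → Fin (suc r) → Vec Bool r
interval {zero}  _       _       = []
interval {suc r} zero    zero    = false ∷ interval zero zero
interval {suc r} zero    (suc b) = true  ∷ interval zero b
interval {suc r} (suc a) zero    = true  ∷ interval a zero
interval {suc r} (suc a) (suc b) = false ∷ interval a b

interval-self : (a : Fin (suc r)) → interval a a ≡ zeroVec
interval-self {zero}  _       = refl
interval-self {suc r} zero    = cong (false ∷_) (interval-self zero)
interval-self {suc r} (suc a) = cong (false ∷_) (interval-self a)

interval-sym : (a b : Fin (suc r)) → interval a b ≡ interval b a
interval-sym {zero}  _       _       = refl
interval-sym {suc r} zero    zero    = refl
interval-sym {suc r} zero    (suc b) = cong (true ∷_) (interval-sym zero b)
interval-sym {suc r} (suc a) zero    = cong (true ∷_) (interval-sym a zero)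
interval-sym {suc r} (suc a) (suc b) = cong (false ∷_) (interval-sym a b)

-- interval a b is the sum of the "potentials" interval 0 a and interval 0 b;
-- this is what makes the columns of a cycle telescope.
interval-potential : (a b : Fin (suc r)) → interval a b ≡ interval zero a ⊕ interval zero b
interval-potential {zero}  _       _       = refl
interval-potential {suc r} zero    zero    = cong (false ∷_) (interval-potential zero zero)
interval-potential {suc r} zero    (suc b) = cong (true ∷_) (interval-potential zero b)
interval-potential {suc r} (suc a) zero    = cong (true ∷_) (interval-potential a zero)
interval-potential {suc r} (suc a) (suc b) = cong (false ∷_) (interval-potential a b)

-- The incidence functional of vertex w: the sum of the coordinates of the (at most
-- two) path edges at w.  On intervals it detects the end points.
first : Vec Bool r → Bool
first []      = false
first (b ∷ _) = b

incidence : Fin (suc r) → Vec Bool r → Bool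
incidence zero                x       = first x
incidence {suc r} (suc zero)    (b ∷ x) = b xor first x
incidence {suc r} (suc (suc w)) (_ ∷ x) = incidence (suc w) x

incidence-linear : (w : Fin (suc r)) → IsLinear (incidence w)
incidence-linear zero          []      []      = refl
incidence-linear zero          (_ ∷ _) (_ ∷ _) = refl
incidence-linear (suc zero)    (a ∷ x) (b ∷ y) =
  trans (cong ((a xor b) xor_) (incidence-linear zero x y)) (interchange a b (first x) (first y))
incidence-linear (suc (suc w)) (_ ∷ x) (_ ∷ y) = incidence-linear (suc w) x y

incidence-interval : (w a b : Fin (suc r)) → incidence w (interval a b) ≡ (a == w) xor (b == w)
incidence-interval {zero}  zero    zero    zero    = refl
incidence-interval {suc r} zero    zero    zero    = refl
incidence-interval {suc r} zero    zero    (suc b) = refl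
incidence-interval {suc r} zero    (suc a) zero    = refl
incidence-interval {suc r} zero    (suc a) (suc b) = refl
incidence-interval {suc r} (suc zero) zero zero = incidence-interval {r} zero zero zero
incidence-interval {suc r} (suc zero) zero (suc b)
  rewrite incidence-interval zero zero b with b == zero
... | true  = refl
... | false = refl
incidence-interval {suc r} (suc zero) (suc a) zero
  rewrite incidence-interval zero a zero with a == zero
... | true  = refl
... | false = refl
incidence-interval {suc r} (suc zero) (suc a) (suc b)
  rewrite incidence-interval zero a b = refl
incidence-interval {suc r} (suc (suc w)) zero    zero    = incidence-interval (suc w) zero zero
incidence-interval {suc r} (suc (suc w)) zero    (suc b) = incidence-interval (suc w) zero b
incidence-interval {suc r} (suc (suc w)) (suc a) zero    = incidence-interval (suc w) a zero
incidence-interval {suc r} (suc (suc w)) (suc a) (suc b) = incidence-interval (suc w) a b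

incidence-end : {a b : Fin (suc r)} → a ≢ b → incidence b (interval a b) ≡ true
incidence-end {a = a} {b} a≢b = begin
  incidence b (interval a b) ≡⟨ incidence-interval b a b ⟩
  (a == b) xor (b == b)      ≡⟨ cong₂ _xor_ (==-≢ a≢b) (==-refl b) ⟩
  true ∎
  where open ≡-Reasoning

incidence-at-end : (w a b : Fin (suc r)) → incidence w (interval a b) ≡ true → a ≡ w ⊎ b ≡ w
incidence-at-end w a b detected with a ≟ w | incidence-interval w a b
... | yes a≡w | _     = inj₁ a≡w
... | no  _   | value = inj₂ (==⇒≡ b w (trans (sym value) detected))

interval-nonzero : {a b : Fin (suc r)} → a ≢ b → interval a b ≢ zeroVec
interval-nonzero {b = b} a≢b zero-interval = case evaluate of λ ()
  where
  evaluate : true ≡ false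
  evaluate = trans (sym (incidence-end a≢b))
                   (trans (cong (incidence b) zero-interval)
                          (linear-zero (incidence b) (incidence-linear b)))

interval-injective : {a b c d : Fin (suc r)} → a ≢ b → interval a b ≡ interval c d →
                     (a ≡ c × b ≡ d) ⊎ (a ≡ d × b ≡ c)
interval-injective {a = a} {b} {c} {d} a≢b same
  with incidence-at-end a c d (trans (cong (incidence a) (trans (sym same) (interval-sym a b)))
                                     (incidence-end (a≢b ∘ sym)))
     | incidence-at-end b c d (trans (cong (incidence b) (sym same)) (incidence-end a≢b))
... | inj₁ refl | inj₂ refl = inj₁ (refl , refl)
... | inj₂ refl | inj₁ refl = inj₂ (refl , refl)
... | inj₁ refl | inj₁ refl = ⊥-elim (a≢b refl)
... | inj₂ refl | inj₂ refl = ⊥-elim (a≢b refl)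

interval-self-lookup : (a : Fin (suc r)) (c : Fin r) → lookup (interval a a) c ≡ false
interval-self-lookup a c = trans (cong (λ x → lookup x c) (interval-self a)) (lookup-replicate c false)

potential-downward : (b : Fin (suc r)) {j k : Fin r} → j ≤ᶠ k →
                     lookup (interval zero b) k ≡ true → lookup (interval zero b) j ≡ true
potential-downward {suc r} zero    {k = k} _ k∈ =
  case trans (sym k∈) (interval-self-lookup zero k) of λ ()
potential-downward {suc r} (suc b) {zero}  _ _  = refl
potential-downward {suc r} (suc b) {suc j} {suc k} (s≤s j≤k) k∈ = potential-downward b j≤k k∈

interval-consecutive : (a b : Fin (suc r)) → Consecutive1s (interval a b)
interval-consecutive {suc r} _ _ zero zero _ _ _ i∈ _ = i∈
interval-consecutive {suc r} zero    zero    zero (suc j) _ _ _ () _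
interval-consecutive {suc r} (suc a) (suc b) zero (suc j) _ _ _ () _
interval-consecutive {suc r} zero    (suc b) zero (suc j) (suc k) _ (s≤s j≤k) _ k∈ =
  potential-downward b j≤k k∈
interval-consecutive {suc r} (suc a) zero    zero (suc j) (suc k) _ (s≤s j≤k) _ k∈
  rewrite interval-sym a zero = potential-downward a j≤k k∈
interval-consecutive {suc r} zero    zero    (suc i) (suc j) (suc k) (s≤s i≤j) (s≤s j≤k) =
  interval-consecutive zero zero i j k i≤j j≤k
interval-consecutive {suc r} zero    (suc b) (suc i) (suc j) (suc k) (s≤s i≤j) (s≤s j≤k) =
  interval-consecutive zero b i j k i≤j j≤k
interval-consecutive {suc r} (suc a) zero    (suc i) (suc j) (suc k) (s≤s i≤j) (s≤s j≤k) =
  interval-consecutive a zero i j k i≤j j≤k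
interval-consecutive {suc r} (suc a) (suc b) (suc i) (suc j) (suc k) (s≤s i≤j) (s≤s j≤k) =
  interval-consecutive a b i j k i≤j j≤k

consecutive⇒interval : (x : Vec Bool r) → Consecutive1s x → ∃[ a ] ∃[ b ] interval a b ≡ x
consecutive⇒interval []      _    = zero , zero , refl
consecutive⇒interval (h ∷ x) cons with consecutive⇒interval x tail-consecutive
  where
  tail-consecutive : Consecutive1s x
  tail-consecutive i j k i≤j j≤k = cons (suc i) (suc j) (suc k) (s≤s i≤j) (s≤s j≤k)
consecutive⇒interval (false ∷ x)        _    | a , b , eq = suc a , suc b , cong (false ∷_) eq
consecutive⇒interval (true ∷ [])        _    | _          = zero , suc zero , refl
consecutive⇒interval (true ∷ false ∷ x) cons | _          =
  zero , suc zero , cong (λ y → true ∷ false ∷ y) (trans (interval-self zero) (sym rest-zero))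
  where
  -- a 1 after the gap at coordinate 1 would contradict consecutiveness
  no-one : ∀ c → lookup x c ≡ false
  no-one c with lookup x c in xc
  ... | false = refl
  ... | true  = case cons zero (suc zero) (suc (suc c)) z≤n (s≤s z≤n) refl xc of λ ()
  rest-zero : x ≡ zeroVec
  rest-zero = vec-ext (λ c → trans (no-one c) (sym (lookup-replicate c false)))
consecutive⇒interval (true ∷ true ∷ x)  _    | zero  , zero  , ()
consecutive⇒interval (true ∷ true ∷ x)  _    | zero  , suc b , eq = zero , suc (suc b) , cong (true ∷_) eq
consecutive⇒interval (true ∷ true ∷ x)  _    | suc a , zero  , eq = suc (suc a) , zero , cong (true ∷_) eq
consecutive⇒interval (true ∷ true ∷ x)  _    | suc a , suc b , ()

leastWitness : {P : ℕ → Set} → Decidable P →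
               ∀ {n} → P n → ∃[ j ] (P j × (∀ {i} → i < j → ¬ P i))
leastWitness {P = P} P? {n} Pn = search n (<-wellFounded n) Pn
  where
  search : ∀ n → Acc _<_ n → P n → ∃[ j ] (P j × (∀ {i} → i < j → ¬ P i))
  search n (acc smaller) Pn with anyUpTo? P? n
  ... | yes (i , i<n , Pi) = search i (smaller i<n) Pi
  ... | no  none           = n , Pn , λ i<n Pi → none (_ , i<n , Pi)

record FirstRepetition {A : Set} (s : ℕ → A) : Set where
  field
    earlier later : ℕ
    earlier<later : earlier < later
    repeats       : s earlier ≡ s later
    injective     : ∀ {a b} → a < later → b < later → s a ≡ s b → a ≡ b

firstRepetition : ∀ {N} (s : ℕ → Fin N) → FirstRepetition s
firstRepetition {N} s =
  fromLeast (leastWitness (λ j → anyUpTo? (λ i → s i ≟ s j) j) (proj₂ some-repetition))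
  where
  Repeated : ℕ → Set
  Repeated j = ∃[ i ] (i < j × s i ≡ s j)

  some-repetition : ∃[ j ] Repeated j
  some-repetition with pigeonhole (n<1+n N) (s ∘ toℕ)
  ... | i , j , i<j , same = toℕ j , toℕ i , i<j , same

  fromLeast : ∃[ j ] (Repeated j × (∀ {i} → i < j → ¬ Repeated i)) → FirstRepetition s
  fromLeast (j , (i , i<j , si≡sj) , minimal) = record
    { earlier = i ; later = j ; earlier<later = i<j ; repeats = si≡sj ; injective = injective }
    where
    injective : ∀ {a b} → a < j → b < j → s a ≡ s b → a ≡ b
    injective {a} {b} a<j b<j sa≡sb with <-cmp a b
    ... | tri< a<b _ _ = ⊥-elim (minimal b<j (a , a<b , sa≡sb))
    ... | tri≈ _ a≡b _ = a≡b
    ... | tri> _ _ b<a = ⊥-elim (minimal a<j (b , b<a , sym sa≡sb))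

module _ (G : Graph) where
  open Graph G

  Incident : Fin nE → Fin nV → Set
  Incident e w = proj₁ (ends e) ≡ w ⊎ proj₂ (ends e) ≡ w

  Incident? : ∀ e w → Dec (Incident e w)
  Incident? e w = (proj₁ (ends e) ≟ w) ⊎-dec (proj₂ (ends e) ≟ w)

  joins-ends : ∀ e → Joins G e (proj₁ (ends e)) (proj₂ (ends e))
  joins-ends e = inj₁ refl

  joins-sym : ∀ {e u w} → Joins G e u w → Joins G e w u
  joins-sym (inj₁ e≡uw) = inj₂ e≡uw
  joins-sym (inj₂ e≡wu) = inj₁ e≡wu

  joins-unique : ∀ {e a b c d} → Joins G e a b → Joins G e c d →
                 (a ≡ c × b ≡ d) ⊎ (a ≡ d × b ≡ c)
  joins-unique (inj₁ refl) (inj₁ eq) = inj₁ (cong proj₁ eq , cong proj₂ eq)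
  joins-unique (inj₁ refl) (inj₂ eq) = inj₂ (cong proj₁ eq , cong proj₂ eq)
  joins-unique (inj₂ refl) (inj₁ eq) = inj₂ (cong proj₂ eq , cong proj₁ eq)
  joins-unique (inj₂ refl) (inj₂ eq) = inj₁ (cong proj₂ eq , cong proj₁ eq)

  NoParallelEdges : Set
  NoParallelEdges = ∀ e f → Joins G e (proj₁ (ends f)) (proj₂ (ends f)) → e ≡ f

  Loopless : Set
  Loopless = ∀ e → proj₁ (ends e) ≢ proj₂ (ends e)

  joins-distinct : Loopless → ∀ {e u w} → Joins G e u w → u ≢ w
  joins-distinct loopless {e} (inj₁ refl) = loopless e
  joins-distinct loopless {e} (inj₂ refl) = loopless e ∘ sym

  NoPendantEdge : Subset nE → Set
  NoPendantEdge T = ∀ {e u w} → e ∈ T → Joins G e u w →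
                    ∃[ f ] (f ∈ T × f ≢ e × Incident f w)

  record Traversal (T : Subset nE) : Set where
    constructor traversal
    field
      from to : Fin nV
      via     : Fin nE
      via∈T   : via ∈ T
      joins   : Joins G via from to

  continue : NoParallelEdges → {T : Subset nE} → NoPendantEdge T → (t : Traversal T) →
             ∃[ x ] ∃[ f ] (f ∈ T × Joins G f (Traversal.to t) x × x ≢ Traversal.from t)
  continue parallel-free noPendant (traversal u w e e∈T e-joins) with noPendant e∈T e-joins
  ... | f , f∈T , f≢e , inj₁ start≡w =
    proj₂ (ends f) , f , f∈T , inj₁ (cong (_, proj₂ (ends f)) start≡w) , back
    where
    back : proj₂ (ends f) ≢ u
    back end≡u = f≢e (sym (parallel-free e f
      (subst₂ (Joins G e) (sym start≡w) (sym end≡u) (joins-sym e-joins))))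
  ... | f , f∈T , f≢e , inj₂ end≡w =
    proj₁ (ends f) , f , f∈T , inj₂ (cong (proj₁ (ends f) ,_) end≡w) , back
    where
    back : proj₁ (ends f) ≢ u
    back start≡u = f≢e (sym (parallel-free e f
      (subst₂ (Joins G e) (sym start≡u) (sym end≡w) e-joins)))

  record NonBacktrackingWalk (T : Subset nE) : Set where
    field
      vertex          : ℕ → Fin nV
      edge            : ℕ → Fin nE
      edge∈T          : ∀ m → edge m ∈ T
      joins           : ∀ m → Joins G (edge m) (vertex m) (vertex (suc m))
      nonBacktracking : ∀ m → vertex (suc (suc m)) ≢ vertex m

  nonBacktrackingWalk : NoParallelEdges → {T : Subset nE} → NoPendantEdge T →
                        ∀ {e} → e ∈ T → NonBacktrackingWalk T
  nonBacktrackingWalk parallel-free {T} noPendant {e} e∈T = record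
    { vertex          = Traversal.from ∘ traversals
    ; edge            = Traversal.via ∘ traversals
    ; edge∈T          = Traversal.via∈T ∘ traversals
    ; joins           = Traversal.joins ∘ traversals
    ; nonBacktracking = next-turns ∘ traversals
    }
    where
    next : Traversal T → Traversal T
    next t with continue parallel-free noPendant t
    ... | x , f , f∈T , f-joins , _ = traversal (Traversal.to t) x f f∈T f-joins

    next-turns : ∀ t → Traversal.to (next t) ≢ Traversal.from t
    next-turns t with continue parallel-free noPendant t
    ... | _ , _ , _ , _ , x≢from = x≢from

    traversals : ℕ → Traversal T
    traversals zero    = traversal (proj₁ (ends e)) (proj₂ (ends e)) e e∈T (joins-ends e)
    traversals (suc m) = next (traversals m)

  -- The stretch of a non-backtracking walk up to its first repeated vertex is a
  -- cycle with all its edges in T.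
  walk-cycle : ∀ {T} → NonBacktrackingWalk T → Σ (Cycle G) (λ C → CycleIn G C T)
  walk-cycle {T} W = C , λ t → edge∈T (pos t)
    where
    open NonBacktrackingWalk W
    open FirstRepetition (firstRepetition vertex)

    -- the cycle has k+1 vertices, at positions earlier, …, earlier + k = later - 1
    k : ℕ
    k = proj₁ (m≤n⇒∃[o]m+o≡n earlier<later)

    later≡ : suc (k + earlier) ≡ later
    later≡ = trans (cong suc (+-comm k earlier)) (proj₂ (m≤n⇒∃[o]m+o≡n earlier<later))

    pos : Fin (suc k) → ℕ
    pos t = toℕ t + earlier

    pos<later : ∀ t → pos t < later
    pos<later t = subst (pos t <_) later≡ (+-monoˡ-< earlier (toℕ<n t))

    pos-injective : ∀ {t t′} → pos t ≡ pos t′ → t ≡ t′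
    pos-injective = toℕ-injective ∘ +-cancelʳ-≡ earlier _ _

    -- traversing an edge backwards later on would force an immediate turn back
    no-return : ∀ {a b} → a < b → b < later →
                vertex a ≡ vertex (suc b) → vertex (suc a) ≡ vertex b → ⊥₀
    no-return a<b b<later va≡vb+1 va+1≡vb with injective (≤-<-trans a<b b<later) b<later va+1≡vb
    ... | refl = nonBacktracking _ (sym va≡vb+1)

    edge-injective : ∀ {a b} → a < later → b < later → edge a ≡ edge b → a ≡ b
    edge-injective {a} {b} a<later b<later same
      with joins-unique (joins a)
                        (subst (λ f → Joins G f (vertex b) (vertex (suc b))) (sym same) (joins b))
    ... | inj₁ (va≡vb , _) = injective a<later b<later va≡vb
    ... | inj₂ (va≡vb+1 , va+1≡vb) with <-cmp a b
    ...   | tri< a<b _ _ = ⊥-elim (no-return a<b b<later va≡vb+1 va+1≡vb)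
    ...   | tri≈ _ a≡b _ = a≡b
    ...   | tri> _ _ b<a = ⊥-elim (no-return b<a a<later (sym va+1≡vb) (sym va≡vb+1))

    closes : vertex (suc (pos (fromℕ k))) ≡ vertex (pos zero)
    closes = trans (cong (λ p → vertex (suc (p + earlier))) (toℕ-fromℕ k))
                   (trans (cong vertex later≡) (sym repeats))

    C : Cycle G
    C = record
      { k      = k
      ; vs     = vertex ∘ pos
      ; es     = edge ∘ pos
      ; vs-inj = λ same → pos-injective (injective (pos<later _) (pos<later _) same)
      ; es-inj = λ same → pos-injective (edge-injective (pos<later _) (pos<later _) same)
      ; step   = λ t → subst (Joins G (edge (pos (inject₁ t))) (vertex (pos (inject₁ t))))
                             (cong (λ p → vertex (suc (p + earlier))) (toℕ-inject₁ t))
                             (joins (pos (inject₁ t)))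
      ; close  = subst (Joins G (edge (pos (fromℕ k))) (vertex (pos (fromℕ k)))) closes
                       (joins (pos (fromℕ k)))
      }

graphOn : ∀ r n → (Fin n → Fin (suc r) × Fin (suc r)) → Graph
graphOn r n ends = record { nV = suc r ; nE = n ; ends = ends }

intervalMatrix : (Fin n → Fin (suc r) × Fin (suc r)) → Matrix₂ r n
intervalMatrix ends e = interval (proj₁ (ends e)) (proj₂ (ends e))

module IntervalRepresentation {r n : ℕ} (ends : Fin n → Fin (suc r) × Fin (suc r)) where
  G : Graph
  G = graphOn r n ends

  A : Matrix₂ r n
  A = intervalMatrix ends

  column-joins : ∀ {e u w} → Joins G e u w → A e ≡ interval u w
  column-joins (inj₁ refl) = refl
  column-joins (inj₂ refl) = interval-sym _ _

  -- The columns of the edges of a cycle sum to zero: coordinatewise, each column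
  -- is a difference of potentials and the sum telescopes around the cycle.
  cycle-sum : (C : Cycle G) → colSum A (range (Cycle.es C)) ≡ zeroVec
  cycle-sum C = vec-ext λ c → begin
    lookup (colSum A (range es)) c
      ≡⟨ linear-colSum (λ x → lookup x c) (coordinate-linear c) A (range es) ⟩
    subsetSum (λ e → lookup (A e) c) (range es)
      ≡⟨ subsetSum-range (λ e → lookup (A e) c) es es-inj ⟩
    sum (λ i → lookup (A (es i)) c)
      ≡⟨ cyclic-telescope k (λ i → potential (vs i) c) (λ i → lookup (A (es i)) c)
                            (edge-term c ∘ step) (edge-term c close) ⟩
    false
      ≡⟨ sym (lookup-replicate c false) ⟩
    lookup zeroVec c ∎
    where
    open Cycle C
    open ≡-Reasoning
    potential : Fin (suc r) → Fin r → Bool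
    potential v c = lookup (interval zero v) c
    edge-term : ∀ c {e u w} → Joins G e u w → lookup (A e) c ≡ potential u c xor potential w c
    edge-term c {u = u} {w} e-joins =
      trans (cong (λ x → lookup x c) (trans (column-joins e-joins) (interval-potential u w)))
            (coordinate-linear c (interval zero u) (interval zero w))

  cycle-dependent : ∀ {S} (C : Cycle G) → CycleIn G C S → ¬ LinIndep₂ A S
  cycle-dependent {S} C C⊆S independent =
    ∉⊥ (subst (es zero ∈_) (independent (range es) range⊆S (cycle-sum C)) (range⁺ es zero))
    where
    open Cycle C
    range⊆S : range es ⊆ S
    range⊆S x∈ with range⁻ es x∈
    ... | i , refl = C⊆S i

  -- If columns of a loopless graph sum to zero, then at every vertex w an even
  -- number of the chosen edges meets w (the incidence functional of w vanishes),
  -- so no chosen edge is pendant.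
  zero-sum-noPendant : Loopless G → ∀ {T} → colSum A T ≡ zeroVec → NoPendantEdge G T
  zero-sum-noPendant loopless {T} zero-sum {e} {u} {w} e∈T e-joins
    with any? (λ f → (f ∈? T) ×-dec (¬? (f ≟ e) ×-dec Incident? G f w))
  ... | yes found = found
  ... | no  none  = case trans (sym odd) even of λ ()
    where
    even : subsetSum (incidence w ∘ A) T ≡ false
    even = begin
      subsetSum (incidence w ∘ A) T ≡⟨ sym (linear-colSum (incidence w) (incidence-linear w) A T) ⟩
      incidence w (colSum A T)      ≡⟨ cong (incidence w) zero-sum ⟩
      incidence w zeroVec           ≡⟨ linear-zero (incidence w) (incidence-linear w) ⟩
      false ∎
      where open ≡-Reasoning
    only-e : ∀ f → f ∈ T → incidence w (A f) ≡ true → f ≡ e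
    only-e f f∈T detected with f ≟ e
    ... | yes f≡e = f≡e
    ... | no  f≢e = ⊥-elim (none (f , f∈T , f≢e , incidence-at-end w _ _ detected))
    odd : subsetSum (incidence w ∘ A) T ≡ true
    odd = subsetSum-unique (incidence w ∘ A) T e∈T
            (trans (cong (incidence w) (column-joins e-joins))
                   (incidence-end (joins-distinct G loopless e-joins)))
            only-e

  acyclic-independent : IsSimple G → ∀ {S} → (∀ C → ¬ CycleIn G C S) → LinIndep₂ A S
  acyclic-independent (loopless , parallel-free) acyclic T T⊆S zero-sum with nonempty? T
  ... | no  empty      = Empty-unique empty
  ... | yes (e , e∈T)
    with walk-cycle G (nonBacktrackingWalk G parallel-free (zero-sum-noPendant loopless zero-sum) e∈T)
  ...   | C , C⊆T = ⊥-elim (acyclic C (λ i → T⊆S (C⊆T i)))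

  cycleMatroid⇔intervalMatroid : IsSimple G →
                                 ∀ S → IndepSystem.Indep (cycleMatroid G) S ⇔ LinIndep₂ A S
  cycleMatroid⇔intervalMatroid simple S =
    mk⇔ (acyclic-independent simple) (λ independent C C⊆S → cycle-dependent C C⊆S independent)

≅-reindex : ∀ {M n} {I J : Subset n → Set} → M ≅ record { size = n ; Indep = I } →
            (∀ S → I S ⇔ J S) → M ≅ record { size = n ; Indep = J }
≅-reindex iso equivalent = record
  { σ = σ ; preserve = λ S → ⇔.trans (preserve S) (equivalent (image σ S)) }
  where open _≅_ iso

linIndep-cong : {A B : Matrix₂ r n} → (∀ j → A j ≡ B j) → ∀ S → LinIndep₂ A S ⇔ LinIndep₂ B S
linIndep-cong same S = mk⇔
  (λ independent T T⊆S zero-sum → independent T T⊆S (trans (colSum-cong same T) zero-sum))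
  (λ independent T T⊆S zero-sum → independent T T⊆S (trans (sym (colSum-cong same T)) zero-sum))

module Vertexless {n : ℕ} (ends : Fin n → Fin 0 × Fin 0) where
  no-edge : Fin n → ⊥₀
  no-edge e = case proj₁ (ends e) of λ ()

  noColumns : Matrix₂ 0 n
  noColumns _ = []

  simpleSegment : IsSimpleSegment noColumns
  simpleSegment = (λ _ ()) , (λ e → ⊥-elim (no-edge e)) , λ {e} _ → ⊥-elim (no-edge e)

  independence : ∀ S → IndepSystem.Indep (cycleMatroid (record { nV = 0 ; nE = n ; ends = ends })) S
                     ⇔ LinIndep₂ noColumns S
  independence S = mk⇔ (λ _ T _ _ → Empty-unique (no-edge ∘ proj₁))
                       (λ _ C _ → case Cycle.vs C zero of λ ())

interval-simpleSegment : (ends : Fin n → Fin (suc r) × Fin (suc r)) →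
                         IsSimple (graphOn r n ends) → IsSimpleSegment (intervalMatrix ends)
interval-simpleSegment ends (loopless , parallel-free) =
  (λ e → interval-consecutive _ _) , (λ e → interval-nonzero (loopless e)) , injective
  where
  injective : Injective _≡_ _≡_ (intervalMatrix ends)
  injective {e} {f} same with interval-injective (loopless e) same
  ... | inj₁ (a≡c , b≡d) = parallel-free e f (inj₁ (cong₂ _,_ a≡c b≡d))
  ... | inj₂ (a≡d , b≡c) = parallel-free e f (inj₂ (cong₂ _,_ a≡d b≡c))

module SegmentGraph {r n : ℕ} (A : Matrix₂ r n) (segment : IsSegment A)
                    (nonzero : ∀ j → A j ≢ zeroVec) (distinct : Injective _≡_ _≡_ A) where
  ends : Fin n → Fin (suc r) × Fin (suc r)
  ends e = proj₁ (consecutive⇒interval (A e) (segment e)) ,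
           proj₁ (proj₂ (consecutive⇒interval (A e) (segment e)))

  column : ∀ e → intervalMatrix ends e ≡ A e
  column e = proj₂ (proj₂ (consecutive⇒interval (A e) (segment e)))

  simple : IsSimple (graphOn r n ends)
  simple = loopless , parallel-free
    where
    loopless : Loopless (graphOn r n ends)
    loopless e a≡b = nonzero e
      (trans (sym (column e)) (trans (cong (interval _) (sym a≡b)) (interval-self _)))
    parallel-free : NoParallelEdges (graphOn r n ends)
    parallel-free e f (inj₁ same-ends) = distinct
      (trans (sym (column e)) (trans (cong (λ p → interval (proj₁ p) (proj₂ p)) same-ends) (column f)))
    parallel-free e f (inj₂ swapped-ends) = distinct
      (trans (sym (column e)) (trans (cong (λ p → interval (proj₁ p) (proj₂ p)) swapped-ends)
                                     (trans (interval-sym _ _) (column f))))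

graphic⇒segment : (M : Matroid) → IsSimpleGraphic M → IsoToSimpleSegmentBinary M
graphic⇒segment M (record { nV = zero ; nE = n ; ends = ends } , _ , iso) =
  0 , n , noColumns , simpleSegment , ≅-reindex iso independence
  where open Vertexless ends
graphic⇒segment M (record { nV = suc r ; nE = n ; ends = ends } , simple , iso) =
  r , n , intervalMatrix ends , interval-simpleSegment ends simple ,
  ≅-reindex iso (IntervalRepresentation.cycleMatroid⇔intervalMatroid ends simple)

segment⇒graphic : (M : Matroid) → IsoToSimpleSegmentBinary M → IsSimpleGraphic M
segment⇒graphic M (r , n , A , (segment , nonzero , distinct) , iso) =
  graphOn r n ends , simple ,
  ≅-reindex iso (λ S → ⇔.trans (linIndep-cong (sym ∘ column) S)
                               (⇔.sym (IntervalRepresentation.cycleMatroid⇔intervalMatroid ends simple S)))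
  where open SegmentGraph A segment nonzero distinct

theorem3 : (M : Matroid) → IsSimpleGraphic M ⇔ IsoToSimpleSegmentBinary M
theorem3 M = mk⇔ (graphic⇒segment M) (segment⇒graphic M)
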